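{- Let $\mathbb{K}$ be a class of $\mathcal{L}$-structures which is universally axiomatizable and is FIT or UNCAF, and suppose $\mathbb{K}$ has both finite and infinite members. Let $\mathbb{K}'\subseteq\mathbb{K}$ be the class of infinite members of $\mathbb{K}$. Then $\mathbb{K}'$ is not FIT, not fg-FIT, and not UNCAF.
   Context: An UNCAF sentence is one of the form $\forall x_1,\dots,x_n\,\neg\bigwedge_{i} \varphi_i(x_1,\dots,x_n)$ with finitely many atomic formulas $\varphi_i$; a class is UNCAF if it is the class of models of a set of UNCAF sentences. A class $\mathbb{K}$ is FIT if (i) $\mathbb{K}\neq\operatorname{Str}(\mathcal{L})$, (ii) every $\mathcal{L}$-structure all of whose finite substructures lie in $\mathbb{K}$ lies in $\mathbb{K}$, and (iii) every finite substructure of a member of $\mathbb{K}$ lies in $\mathbb{K}$; fg-FIT is defined the same way with "finitely generated substructures" in place of "finite substructures". Universally axiomatizable means being the class of models of a set of universal first-order sentences. -}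

module Defs where

open import Level using (0ℓ)
open import Data.Nat using (ℕ)
open import Data.Fin using (Fin)
open import Data.Vec using (Vec; []; _∷_; map)
open import Data.Vec.Relation.Unary.All using (All; []; _∷_)
open import Data.List using (List)
import Data.List.Relation.Unary.All as LAll
open import Data.Product using (Σ; ∃; ∃-syntax; _×_; _,_; proj₁; proj₂)
open import Data.Sum using (_⊎_)
open import Data.Empty using (⊥)
open import Relation.Nullary using (¬_)
open import Relation.Binary.PropositionalEquality using (_≡_)
open import Function.Bundles using (_↔_)

Finite : Set → Set
Finite A = ∃[ n ] (A ↔ Fin n)

Infinite : Set → Set
Infinite A = ¬ Finite A

record Language : Set₁ where
  field
    Rel   : Set
    rar   : Rel → ℕ
    Fun   : Set            -- constants are 0-ary function symbols
    far   : Fun → ℕ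

module _ (L : Language) where
  open Language L

  -- L-structures (the empty structure is allowed)
  record Str : Set₁ where
    field
      Carrier : Set
      relI    : (R : Rel) → Vec Carrier (rar R) → Set
      funI    : (f : Fun) → Vec Carrier (far f) → Carrier

  data Term (n : ℕ) : Set where
    var : Fin n → Term n
    app : (f : Fun) → Vec (Term n) (far f) → Term n

  data Atom (n : ℕ) : Set where
    equ : Term n → Term n → Atom n
    rel : (R : Rel) → Vec (Term n) (rar R) → Atom n

  data QF (n : ℕ) : Set where
    atom : Atom n → QF n
    ff   : QF n
    neg  : QF n → QF n
    and  : QF n → QF n → QF n
    or   : QF n → QF n → QF n

  record USentence : Set where
    constructor ∀[_]_
    field
      nvars : ℕ
      body  : QF nvars

  record UNCAFSentence : Set where
    constructor ∀¬⋀[_]_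
    field
      nvars : ℕ
      atoms : List (Atom nvars)

  module Semantics (M : Str) where
    open Str M

    mutual
      eval : ∀ {n} → Vec Carrier n → Term n → Carrier
      eval ρ (var i)    = Data.Vec.lookup ρ i
      eval ρ (app f ts) = funI f (evalVec ρ ts)

      evalVec : ∀ {n k} → Vec Carrier n → Vec (Term n) k → Vec Carrier k
      evalVec ρ []       = []
      evalVec ρ (t ∷ ts) = eval ρ t ∷ evalVec ρ ts

    holdsA : ∀ {n} → Vec Carrier n → Atom n → Set
    holdsA ρ (equ s t)  = eval ρ s ≡ eval ρ t
    holdsA ρ (rel R ts) = relI R (evalVec ρ ts)

    holdsQ : ∀ {n} → Vec Carrier n → QF n → Set
    holdsQ ρ (atom a)  = holdsA ρ a
    holdsQ ρ ff        = ⊥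
    holdsQ ρ (neg φ)   = ¬ holdsQ ρ φ
    holdsQ ρ (and φ ψ) = holdsQ ρ φ × holdsQ ρ ψ
    holdsQ ρ (or φ ψ)  = holdsQ ρ φ ⊎ holdsQ ρ ψ

    satU : USentence → Set
    satU (∀[ n ] ψ) = (ρ : Vec Carrier n) → holdsQ ρ ψ

    satUNCAF : UNCAFSentence → Set
    satUNCAF (∀¬⋀[ n ] φs) = (ρ : Vec Carrier n) → ¬ LAll.All (holdsA ρ) φs

  _⊨U_ : Str → USentence → Set
  M ⊨U φ = Semantics.satU M φ

  _⊨N_ : Str → UNCAFSentence → Set
  M ⊨N φ = Semantics.satUNCAF M φ

  Class : Set₁
  Class = Str → Set

  ModU : (USentence → Set) → Class
  ModU T M = ∀ φ → T φ → M ⊨U φ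

  ModN : (UNCAFSentence → Set) → Class
  ModN T M = ∀ φ → T φ → M ⊨N φ

  UniversallyAxiomatizable : Class → Set₁
  UniversallyAxiomatizable K =
    Σ (USentence → Set) λ T → ∀ M → (K M → ModU T M) × (ModU T M → K M)

  UNCAF : Class → Set₁
  UNCAF K =
    Σ (UNCAFSentence → Set) λ T → ∀ M → (K M → ModN T M) × (ModN T M → K M)

  record Sub (M : Str) : Set₁ where
    open Str M
    field
      mem     : Carrier → Set
      memProp : ∀ x (p q : mem x) → p ≡ q
      closed  : ∀ (f : Fun) (xs : Vec Carrier (far f)) → All mem xs → mem (funI f xs)

  private
    allProj : ∀ {A : Set} {P : A → Set} {k} (xs : Vec (Σ A P) k) → All P (map proj₁ xs)
    allProj []       = []
    allProj (x ∷ xs) = proj₂ x ∷ allProj xs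

  induced : {M : Str} → Sub M → Str
  induced {M} S = record
    { Carrier = Σ Carrier mem
    ; relI    = λ R xs → relI R (map proj₁ xs)
    ; funI    = λ f xs → funI f (map proj₁ xs) , closed f (map proj₁ xs) (allProj xs)
    }
    where open Str M ; open Sub S

  FiniteSub : {M : Str} → Sub M → Set
  FiniteSub S = Finite (Σ _ (Sub.mem S))

  GeneratedBy : {M : Str} → Sub M → ∀ {n} → Vec (Str.Carrier M) n → Set₁
  GeneratedBy {M} S gs =
    All (Sub.mem S) gs ×
    (∀ (S' : Sub M) → All (Sub.mem S') gs → ∀ x → Sub.mem S x → Sub.mem S' x)

  FinGenSub : {M : Str} → Sub M → Set₁
  FinGenSub {M} S = Σ ℕ λ n → Σ (Vec (Str.Carrier M) n) λ gs → GeneratedBy S gs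

  FIT : Class → Set₁
  FIT K =
    ¬ (∀ M → K M) ×
    (∀ M → (∀ (S : Sub M) → FiniteSub S → K (induced S)) → K M) ×
    (∀ M → K M → ∀ (S : Sub M) → FiniteSub S → K (induced S))

  fgFIT : Class → Set₁
  fgFIT K =
    ¬ (∀ M → K M) ×
    (∀ M → (∀ (S : Sub M) → FinGenSub S → K (induced S)) → K M) ×
    (∀ M → K M → ∀ (S : Sub M) → FinGenSub S → K (induced S))

  InfiniteMembers : Class → Class
  InfiniteMembers K M = K M × Infinite (Str.Carrier M)

{-# OPTIONS --safe #-}
module Submission where

-- It suffices to find an infinite G ∈ K with a finite substructure S: S lies in no
-- class of infinite structures, yet FIT and fg-FIT classes contain the finite
-- substructures of their members, and UNCAF classes are closed under preimages of
-- homomorphisms, in particular under substructures.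
--
-- Let F ∈ K be finite. If K is UNCAF and F has a point a₀, glue ℕ onto F, letting the
-- operations read every new element as a₀; collapsing onto F is a homomorphism, so
-- the result is in K, with F as a finite substructure. If F is empty, there are no
-- constants, so the empty set is a substructure of the given infinite member.
--
-- If K is FIT and some function symbol has positive arity, glue ℕ onto F so that an
-- operation returns m + 1 when its first argument outside F is m. Then every finite
-- substructure lies inside F, hence satisfies the universal theory of K, and FIT
-- puts the glued structure in K. If all symbols are constants and there are finitely
-- many, their values form a finite substructure of the infinite member. Otherwise
-- K contains every nonempty structure M: given a universal axiom ∀x̄ψ, give the
-- constants not occurring in ψ fresh pairwise distinct values; the resulting
-- structure has no finite substructure, so it is in K, and it contains M as a
-- substructure as far as the symbols of ψ are concerned, so M satisfies ψ.

open import Defs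
import Level
open import Level using (0ℓ)
open import Axiom.ExcludedMiddle using (ExcludedMiddle)
open import Data.Bool.Properties using (T-irrelevant)
open import Data.Empty using (⊥; ⊥-elim)
open import Data.Fin using (Fin; zero; suc)
open import Data.Fin.Properties using (ℕ→Fin-notInjective; ¬Fin0)
open import Data.List using (List; []; _∷_; _++_; length; lookup; deduplicate; mapMaybe; allFin)
import Data.List as List
import Data.List.Relation.Unary.All as LAll
import Data.List.Relation.Unary.Any as Any
open import Data.List.Relation.Unary.Any using (here; there; index)
open import Data.List.Relation.Unary.Any.Properties using (lookup-index; mapMaybe⁺; map⁺)
open import Data.List.Membership.Propositional using (_∈_; _∉_)
open import Data.List.Membership.Propositional.Properties
  using (∈-++⁺ˡ; ∈-++⁺ʳ; ∈-map⁺; ∈-lookup; ∈-allFin; ∈-deduplicate⁺)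
open import Data.List.Membership.Propositional.Properties.WithK using (unique⇒irrelevant)
open import Data.List.Relation.Unary.Unique.DecPropositional.Properties using (deduplicate-!)
open import Data.Maybe using (Maybe)
import Data.Maybe.Relation.Unary.Any as MAny
open import Data.Nat using (ℕ; zero; suc; _+_)
open import Data.Nat.Properties using (_≟_; +-cancelʳ-≡)
open import Data.Product using (Σ; ∃-syntax; _×_; _,_; proj₁; proj₂)
open import Data.Product.Function.NonDependent.Propositional using (_×-⇔_)
open import Data.Sum using (_⊎_; inj₁; inj₂; [_,_]′; isInj₂; fromInj₁)
import Data.Sum as Sum
open import Data.Sum.Properties using (inj₁-injective; inj₂-injective)
open import Data.Sum.Function.Propositional using (_⊎-⇔_)
open import Data.Unit using (⊤; tt)
open import Data.Vec using (Vec; []; _∷_; map; replicate; tabulate)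
open import Data.Vec.Properties using (lookup-map; map-∘; map-id; map-cong)
open import Data.Vec.Relation.Unary.All using (All; []; _∷_)
open import Data.Vec.Relation.Unary.All.Properties using (tabulate⁺; tabulate⁻)
open import Function using (_∘_; const)
open import Function.Bundles using (_↔_; Inverse; mk↔ₛ′; _⇔_; mk⇔; Equivalence; Injection)
open import Function.Construct.Identity using (⇔-id)
open import Function.Definitions using (Injective)
open import Function.Properties.Inverse using (↔-trans; ↔⇒↣)
open import Function.Related.TypeIsomorphisms using (¬-cong-⇔)
open import Relation.Binary.Definitions using (DecidableEquality)
open import Relation.Binary.PropositionalEquality
open import Relation.Nullary using (¬_; Dec; yes; no; contradiction)
open import Relation.Nullary.Decidable using (True; toWitness; fromWitness; decidable-stable)

private
  variable
    A B : Set

ℕ-injection⇒infinite : (g : ℕ → A) → Injective _≡_ _≡_ g → Infinite A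
ℕ-injection⇒infinite g g-inj (n , A↔Fin) =
  ℕ→Fin-notInjective (to ∘ g) (g-inj ∘ Injection.injective (↔⇒↣ A↔Fin))
  where open Inverse A↔Fin

⊎ℕ-infinite : Infinite (A ⊎ ℕ)
⊎ℕ-infinite = ℕ-injection⇒infinite inj₂ inj₂-injective

Enumerable : Set → Set
Enumerable A = Σ (List A) λ xs → ∀ a → a ∈ xs

index-∈-lookup : (xs : List A) (i : Fin (length xs)) → index (∈-lookup {xs = xs} i) ≡ i
index-∈-lookup (x ∷ xs) zero    = refl
index-∈-lookup (x ∷ xs) (suc i) = cong suc (index-∈-lookup xs i)

-- Excluded middle makes equality decidable, so duplicates can be removed;
-- positions in the remaining list then count the elements.
enumerable⇒finite : ExcludedMiddle 0ℓ → Enumerable A → Finite A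
enumerable⇒finite {A} em (xs , xs-complete) =
  length ys , mk↔ₛ′ (index ∘ complete) (lookup ys) index-lookup lookup-index′
  where
    _≟A_ : DecidableEquality A
    x ≟A y = em
    ys : List A
    ys = deduplicate _≟A_ xs
    complete : ∀ a → a ∈ ys
    complete a = ∈-deduplicate⁺ _≟A_ (xs-complete a)
    index-lookup : ∀ i → index (complete (lookup ys i)) ≡ i
    index-lookup i =
      trans (cong index (unique⇒irrelevant (deduplicate-! _≟A_ xs) _ _)) (index-∈-lookup ys i)
    lookup-index′ : ∀ a → lookup ys (index (complete a)) ≡ a
    lookup-index′ a = sym (lookup-index (complete a))

IsInj₁ : A ⊎ B → Set
IsInj₁ = [ const ⊤ , const ⊥ ]′

IsInj₁-irrelevant : (x : A ⊎ B) (p q : IsInj₁ x) → p ≡ q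
IsInj₁-irrelevant (inj₁ _) tt tt = refl

inj₁-part↔ : Σ (A ⊎ B) IsInj₁ ↔ A
inj₁-part↔ {A} {B} = mk↔ₛ′ to (λ a → inj₁ a , tt) (λ _ → refl) from-to
  where
    to : Σ (A ⊎ B) IsInj₁ → A
    to (inj₁ a , _) = a
    from-to : ∀ x → (inj₁ (to x) , tt) ≡ x
    from-to (inj₁ a , tt) = refl

inj₁-part-finite : Finite A → Finite (Σ (A ⊎ B) IsInj₁)
inj₁-part-finite (n , A↔Fin) = n , ↔-trans inj₁-part↔ A↔Fin

emptyVec : ∀ {k} → k ≡ 0 → Vec A k
emptyVec refl = []

emptyVec-unique : ∀ {k} (k≡0 : k ≡ 0) (xs : Vec A k) → xs ≡ emptyVec k≡0
emptyVec-unique refl [] = refl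

All-emptyVec : ∀ {P : A → Set} {k} (k≡0 : k ≡ 0) (xs : Vec A k) → All P xs
All-emptyVec refl [] = []

All-replicate : ∀ {P : A → Set} k {x} → P x → All P (replicate k x)
All-replicate zero    p = []
All-replicate (suc k) p = p ∷ All-replicate k p

collectInj₁ : ∀ {k} → Vec (A ⊎ B) k → Vec A k ⊎ B
collectInj₁ []            = inj₁ []
collectInj₁ (inj₁ a ∷ xs) = Sum.map₁ (a ∷_) (collectInj₁ xs)
collectInj₁ (inj₂ b ∷ xs) = inj₂ b

collectInj₁-map-inj₁ : ∀ {k} (ys : Vec A k) → collectInj₁ {B = B} (map inj₁ ys) ≡ inj₁ ys
collectInj₁-map-inj₁ []       = refl
collectInj₁-map-inj₁ (y ∷ ys) = cong (Sum.map₁ (y ∷_)) (collectInj₁-map-inj₁ ys)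

collectInj₁-All : ∀ {k} (xs : Vec (A ⊎ B) k) → All IsInj₁ xs → ∃[ ys ] collectInj₁ xs ≡ inj₁ ys
collectInj₁-All []            []       = [] , refl
collectInj₁-All (inj₁ a ∷ xs) (_ ∷ ps) with collectInj₁-All xs ps
... | ys , eq = a ∷ ys , cong (Sum.map₁ (a ∷_)) eq

collectInj₁-replicate : ∀ k (b : B) → k ≢ 0 → collectInj₁ {A = A} (replicate k (inj₂ b)) ≡ inj₂ b
collectInj₁-replicate zero    b k≢0 = contradiction refl k≢0
collectInj₁-replicate (suc k) b k≢0 = refl

module _ (L : Language) where
  open Language L
  open Str

  mutual
    funSymsT : ∀ {n} → Term L n → List Fun
    funSymsT (var i)    = []
    funSymsT (app f ts) = f ∷ funSymsV ts

    funSymsV : ∀ {n k} → Vec (Term L n) k → List Fun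
    funSymsV []       = []
    funSymsV (t ∷ ts) = funSymsT t ++ funSymsV ts

  funSymsA : ∀ {n} → Atom L n → List Fun
  funSymsA (equ s t)  = funSymsT s ++ funSymsT t
  funSymsA (rel R ts) = funSymsV ts

  funSymsQ : ∀ {n} → QF L n → List Fun
  funSymsQ (atom a)  = funSymsA a
  funSymsQ ff        = []
  funSymsQ (neg φ)   = funSymsQ φ
  funSymsQ (and φ ψ) = funSymsQ φ ++ funSymsQ ψ
  funSymsQ (or φ ψ)  = funSymsQ φ ++ funSymsQ ψ

  module _ {M N : Str L} (h : Carrier M → Carrier N) where

    PreservesFuns : List Fun → Set
    PreservesFuns fs = ∀ {f} → f ∈ fs → ∀ xs → h (funI M f xs) ≡ funI N f (map h xs)

    PreservesRels : Set
    PreservesRels = ∀ R xs → relI M R xs → relI N R (map h xs)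

    RespectsRels : Set
    RespectsRels = ∀ R xs → relI M R xs ⇔ relI N R (map h xs)

    record IsHomomorphism : Set where
      field
        preservesFuns : ∀ fs → PreservesFuns fs
        preservesRels : PreservesRels

    record IsEmbedding : Set where
      field
        injective     : Injective _≡_ _≡_ h
        preservesFuns : ∀ fs → PreservesFuns fs
        respectsRels  : RespectsRels

    preservesFuns-++ˡ : ∀ fs gs → PreservesFuns (fs ++ gs) → PreservesFuns fs
    preservesFuns-++ˡ fs gs pres f∈ = pres (∈-++⁺ˡ f∈)

    preservesFuns-++ʳ : ∀ fs gs → PreservesFuns (fs ++ gs) → PreservesFuns gs
    preservesFuns-++ʳ fs gs pres f∈ = pres (∈-++⁺ʳ fs f∈)

    private
      module M = Semantics L M
      module N = Semantics L N

    mutual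
      eval-map : ∀ {n} (ρ : Vec (Carrier M) n) t → PreservesFuns (funSymsT t) →
                 h (M.eval ρ t) ≡ N.eval (map h ρ) t
      eval-map ρ (var i)    pres = sym (lookup-map i h ρ)
      eval-map ρ (app f ts) pres =
        trans (pres (here refl) (M.evalVec ρ ts))
              (cong (funI N f) (evalVec-map ρ ts (pres ∘ there)))

      evalVec-map : ∀ {n k} (ρ : Vec (Carrier M) n) (ts : Vec (Term L n) k) →
                    PreservesFuns (funSymsV ts) → map h (M.evalVec ρ ts) ≡ N.evalVec (map h ρ) ts
      evalVec-map ρ []       pres = refl
      evalVec-map ρ (t ∷ ts) pres =
        cong₂ _∷_ (eval-map ρ t (preservesFuns-++ˡ (funSymsT t) _ pres))
                  (evalVec-map ρ ts (preservesFuns-++ʳ (funSymsT t) _ pres))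

    holdsA-map : IsHomomorphism → ∀ {n} (ρ : Vec (Carrier M) n) a → M.holdsA ρ a → N.holdsA (map h ρ) a
    holdsA-map hom ρ (equ s t) s≡t =
      trans (sym (eval-map ρ s (preservesFuns _))) (trans (cong h s≡t) (eval-map ρ t (preservesFuns _)))
      where open IsHomomorphism hom
    holdsA-map hom ρ (rel R ts) r =
      subst (relI N R) (evalVec-map ρ ts (preservesFuns _)) (preservesRels R _ r)
      where open IsHomomorphism hom

    module _ (h-inj : Injective _≡_ _≡_ h) (h-rels : RespectsRels) where

      holdsA-map⇔ : ∀ {n} (ρ : Vec (Carrier M) n) a → PreservesFuns (funSymsA a) →
                    M.holdsA ρ a ⇔ N.holdsA (map h ρ) a
      holdsA-map⇔ ρ (equ s t) pres = mk⇔
        (λ s≡t → trans (sym h[s]) (trans (cong h s≡t) h[t]))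
        (λ hs≡ht → h-inj (trans h[s] (trans hs≡ht (sym h[t]))))
        where
          h[s] : h (M.eval ρ s) ≡ N.eval (map h ρ) s
          h[s] = eval-map ρ s (preservesFuns-++ˡ (funSymsT s) _ pres)
          h[t] : h (M.eval ρ t) ≡ N.eval (map h ρ) t
          h[t] = eval-map ρ t (preservesFuns-++ʳ (funSymsT s) _ pres)
      holdsA-map⇔ ρ (rel R ts) pres = mk⇔
        (subst (relI N R) h[ts] ∘ Equivalence.to (h-rels R _))
        (Equivalence.from (h-rels R _) ∘ subst (relI N R) (sym h[ts]))
        where
          h[ts] : map h (M.evalVec ρ ts) ≡ N.evalVec (map h ρ) ts
          h[ts] = evalVec-map ρ ts pres

      holdsQ-map⇔ : ∀ {n} (ρ : Vec (Carrier M) n) ψ → PreservesFuns (funSymsQ ψ) →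
                    M.holdsQ ρ ψ ⇔ N.holdsQ (map h ρ) ψ
      holdsQ-map⇔ ρ (atom a)  pres = holdsA-map⇔ ρ a pres
      holdsQ-map⇔ ρ ff        pres = ⇔-id ⊥
      holdsQ-map⇔ ρ (neg φ)   pres = ¬-cong-⇔ (holdsQ-map⇔ ρ φ pres)
      holdsQ-map⇔ ρ (and φ ψ) pres =
        holdsQ-map⇔ ρ φ (preservesFuns-++ˡ (funSymsQ φ) _ pres) ×-⇔
        holdsQ-map⇔ ρ ψ (preservesFuns-++ʳ (funSymsQ φ) _ pres)
      holdsQ-map⇔ ρ (or φ ψ)  pres =
        holdsQ-map⇔ ρ φ (preservesFuns-++ˡ (funSymsQ φ) _ pres) ⊎-⇔
        holdsQ-map⇔ ρ ψ (preservesFuns-++ʳ (funSymsQ φ) _ pres)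

      satU-reflect : ∀ {n} (ψ : QF L n) → PreservesFuns (funSymsQ ψ) →
                     Semantics.satU L N (∀[ n ] ψ) → Semantics.satU L M (∀[ n ] ψ)
      satU-reflect ψ pres N⊨ψ ρ = Equivalence.from (holdsQ-map⇔ ρ ψ pres) (N⊨ψ (map h ρ))

    ModU-reflect : IsEmbedding → ∀ T → ModU L T N → ModU L T M
    ModU-reflect emb T N⊨T (∀[ n ] ψ) ψ∈T =
      satU-reflect injective respectsRels ψ (preservesFuns _) (N⊨T _ ψ∈T)
      where open IsEmbedding emb

    ModN-reflect : IsHomomorphism → ∀ T → ModN L T N → ModN L T M
    ModN-reflect hom T N⊨T (∀¬⋀[ n ] φs) φ∈T ρ M⊨φs =
      N⊨T _ φ∈T (map h ρ) (LAll.map (λ {a} → holdsA-map hom ρ a) M⊨φs)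

  UniversallyAxiomatizable⇒embedding-closed : ∀ {K} → UniversallyAxiomatizable L K →
    ∀ {M N} (h : Carrier M → Carrier N) → IsEmbedding h → K N → K M
  UniversallyAxiomatizable⇒embedding-closed (T , K⇔T) h emb KN =
    proj₂ (K⇔T _) (ModU-reflect h emb T (proj₁ (K⇔T _) KN))

  UNCAF⇒homomorphism-closed : ∀ {K} → UNCAF L K →
    ∀ {M N} (h : Carrier M → Carrier N) → IsHomomorphism h → K N → K M
  UNCAF⇒homomorphism-closed (T , K⇔T) h hom KN =
    proj₂ (K⇔T _) (ModN-reflect h hom T (proj₁ (K⇔T _) KN))

  sub-≡ : ∀ {M} (S : Sub L M) {x y} → x ≡ y → (p : Sub.mem S x) (q : Sub.mem S y) →
          _≡_ {A = Σ (Carrier M) (Sub.mem S)} (x , p) (y , q)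
  sub-≡ S {x} refl p q = cong (x ,_) (Sub.memProp S x p q)

  inclusion-isHomomorphism : ∀ {M} (S : Sub L M) → IsHomomorphism {induced L S} {M} proj₁
  inclusion-isHomomorphism S = record { preservesFuns = λ _ _ _ → refl ; preservesRels = λ _ _ r → r }

  finite⇒finitelyGenerated : ∀ {M} (S : Sub L M) → FiniteSub L S → FinGenSub L S
  finite⇒finitelyGenerated {M} S (n , S↔Fin) = n , gens , tabulate⁺ (proj₂ ∘ from) , minimal
    where
      open Inverse S↔Fin
      gens : Vec (Carrier M) n
      gens = tabulate (proj₁ ∘ from)
      minimal : ∀ (S′ : Sub L M) → All (Sub.mem S′) gens → ∀ x → Sub.mem S x → Sub.mem S′ x
      minimal S′ gens∈S′ x x∈S =
        subst (Sub.mem S′) (cong proj₁ (strictlyInverseʳ (x , x∈S))) (tabulate⁻ gens∈S′ (to (x , x∈S)))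

  FiniteSubCounterexample : Class L → Set₁
  FiniteSubCounterexample K = Σ (Str L) λ G → K G × Σ (Sub L G) λ S → FiniteSub L S × ¬ K (induced L S)

  counterexample⇒¬FIT : ∀ {K} → FiniteSubCounterexample K → ¬ FIT L K
  counterexample⇒¬FIT (G , KG , S , S-fin , ¬KS) (_ , _ , toFiniteSubs) = ¬KS (toFiniteSubs G KG S S-fin)

  counterexample⇒¬fgFIT : ∀ {K} → FiniteSubCounterexample K → ¬ fgFIT L K
  counterexample⇒¬fgFIT (G , KG , S , S-fin , ¬KS) (_ , _ , toFinGenSubs) =
    ¬KS (toFinGenSubs G KG S (finite⇒finitelyGenerated S S-fin))

  counterexample⇒¬UNCAF : ∀ {K} → FiniteSubCounterexample K → ¬ UNCAF L K
  counterexample⇒¬UNCAF (G , KG , S , S-fin , ¬KS) uncaf =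
    ¬KS (UNCAF⇒homomorphism-closed uncaf proj₁ (inclusion-isHomomorphism S) KG)

  FiniteMember InfiniteMember : Class L → Set₁
  FiniteMember K   = Σ (Str L) λ M → K M × Finite (Carrier M)
  InfiniteMember K = Σ (Str L) λ M → K M × Infinite (Carrier M)

  infiniteMembers-counterexample : ∀ {K G} → K G → Infinite (Carrier G) → (S : Sub L G) → FiniteSub L S →
    FiniteSubCounterexample (InfiniteMembers L K)
  infiniteMembers-counterexample KG G-inf S S-fin =
    _ , (KG , G-inf) , S , S-fin , λ S-member → proj₂ S-member S-fin

  -- The closure condition holds because a constant would give F an element.
  emptySub : (F : Str L) → ¬ Carrier F → (M : Str L) → Sub L M
  emptySub F F-empty M = record
    { mem     = const ⊥
    ; memProp = λ _ ()
    ; closed  = λ f xs none → F-empty (funI F f (vecOfNone xs none))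
    }
    where
      vecOfNone : ∀ {k} (xs : Vec (Carrier M) k) → All (const ⊥) xs → Vec (Carrier F) k
      vecOfNone []       []       = []
      vecOfNone (x ∷ xs) (() ∷ _)

  emptySub-finite : (F : Str L) (F-empty : ¬ Carrier F) (M : Str L) → FiniteSub L (emptySub F F-empty M)
  emptySub-finite F F-empty M = 0 , mk↔ₛ′ (λ { (_ , ()) }) (λ ()) (λ ()) (λ { (_ , ()) })

  inflate : (F : Str L) → Carrier F → Str L
  inflate F a₀ = record
    { Carrier = Carrier F ⊎ ℕ
    ; relI    = λ R xs → relI F R (map (fromInj₁ (const a₀)) xs)
    ; funI    = λ f xs → inj₁ (funI F f (map (fromInj₁ (const a₀)) xs))
    }

  collapse-isHomomorphism : (F : Str L) (a₀ : Carrier F) →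
    IsHomomorphism {inflate F a₀} {F} (fromInj₁ (const a₀))
  collapse-isHomomorphism F a₀ = record { preservesFuns = λ _ _ _ → refl ; preservesRels = λ _ _ r → r }

  inflate-inj₁Sub : (F : Str L) (a₀ : Carrier F) → Sub L (inflate F a₀)
  inflate-inj₁Sub F a₀ = record { mem = IsInj₁ ; memProp = IsInj₁-irrelevant ; closed = λ _ _ _ → tt }

  succExt : Str L → Str L
  succExt F = record
    { Carrier = Carrier F ⊎ ℕ
    ; relI    = λ R xs → [ relI F R , const ⊥ ]′ (collectInj₁ xs)
    ; funI    = λ f xs → Sum.map (funI F f) suc (collectInj₁ xs)
    }

  succExt-inj₁Sub : (F : Str L) → Sub L (succExt F)
  succExt-inj₁Sub F = record
    { mem     = IsInj₁
    ; memProp = IsInj₁-irrelevant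
    ; closed  = λ f xs xs∈ →
        subst (IsInj₁ ∘ Sum.map (funI F f) suc) (sym (proj₂ (collectInj₁-All xs xs∈))) tt
    }

  module _ (F : Str L) {f₀ : Fun} (f₀-nonconstant : far f₀ ≢ 0)
           (S : Sub L (succExt F)) (S-finite : FiniteSub L S) where

    inj₂∉finiteSub : ∀ m → ¬ Sub.mem S (inj₂ m)
    inj₂∉finiteSub m m∈S =
      ℕ-injection⇒infinite (λ i → inj₂ (i + m) , iterate i)
        (λ eq → +-cancelʳ-≡ m _ _ (inj₂-injective (cong proj₁ eq))) S-finite
      where
        iterate : ∀ i → Sub.mem S (inj₂ (i + m))
        iterate zero    = m∈S
        iterate (suc i) =
          subst (Sub.mem S)
                (cong (Sum.map (funI F f₀) suc) (collectInj₁-replicate (far f₀) (i + m) f₀-nonconstant))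
                (Sub.closed S f₀ (replicate _ (inj₂ (i + m))) (All-replicate _ (iterate i)))

    toF : Σ _ (Sub.mem S) → Carrier F
    toF (inj₁ a , _)   = a
    toF (inj₂ m , m∈S) = ⊥-elim (inj₂∉finiteSub m m∈S)

    toF-spec : ∀ x → proj₁ x ≡ inj₁ (toF x)
    toF-spec (inj₁ a , _)   = refl
    toF-spec (inj₂ m , m∈S) = ⊥-elim (inj₂∉finiteSub m m∈S)

    collectInj₁-toF : ∀ {k} (xs : Vec (Σ _ (Sub.mem S)) k) → collectInj₁ (map proj₁ xs) ≡ inj₁ (map toF xs)
    collectInj₁-toF xs = begin
      collectInj₁ (map proj₁ xs)          ≡⟨ cong collectInj₁ (map-cong toF-spec xs) ⟩
      collectInj₁ (map (inj₁ ∘ toF) xs)   ≡⟨ cong collectInj₁ (map-∘ inj₁ toF xs) ⟩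
      collectInj₁ (map inj₁ (map toF xs)) ≡⟨ collectInj₁-map-inj₁ (map toF xs) ⟩
      inj₁ (map toF xs)                   ∎
      where open ≡-Reasoning

    toF-isEmbedding : IsEmbedding {induced L S} {F} toF
    toF-isEmbedding = record
      { injective     = λ {x} {y} eq →
          sub-≡ S (trans (toF-spec x) (trans (cong inj₁ eq) (sym (toF-spec y)))) (proj₂ x) (proj₂ y)
      ; preservesFuns = λ _ {f} _ xs →
          inj₁-injective (trans (sym (toF-spec _)) (cong (Sum.map (funI F f) suc) (collectInj₁-toF xs)))
      ; respectsRels  = λ R xs →
          mk⇔ (subst [ relI F R , const ⊥ ]′ (collectInj₁-toF xs))
              (subst [ relI F R , const ⊥ ]′ (sym (collectInj₁-toF xs)))
      }

  FIT⇒succExt-member : ∀ {K} → UniversallyAxiomatizable L K → FIT L K →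
    ∀ {F f₀} → far f₀ ≢ 0 → K F → K (succExt F)
  FIT⇒succExt-member ua (_ , fromFiniteSubs , _) {F} f₀-nonconstant KF =
    fromFiniteSubs (succExt F) λ S S-finite →
      UniversallyAxiomatizable⇒embedding-closed ua _ (toF-isEmbedding F f₀-nonconstant S S-finite) KF

  ¬nonconstant⇒nullary : ¬ (∃[ f ] far f ≢ 0) → ∀ f → far f ≡ 0
  ¬nonconstant⇒nullary no-nonconstant f =
    decidable-stable (far f ≟ 0) λ f-nonconstant → no-nonconstant (f , f-nonconstant)

  module _ (em : ExcludedMiddle 0ℓ) where

    IsValue : (M : Str L) → Carrier M → Set
    IsValue M x = ∃[ f ] Σ (Vec (Carrier M) (far f)) λ xs → funI M f xs ≡ x

    valueSub : (M : Str L) → Sub L M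
    valueSub M = record
      { mem     = λ x → True (em {IsValue M x})
      ; memProp = λ _ → T-irrelevant
      ; closed  = λ f xs _ → fromWitness (f , xs , refl)
      }

    valueSub-finite : (M : Str L) → (∀ f → far f ≡ 0) → Enumerable Fun → FiniteSub L (valueSub M)
    valueSub-finite M nullary (cs , cs-complete) = enumerable⇒finite em (List.map value cs , complete)
      where
        value : Fun → Σ (Carrier M) (Sub.mem (valueSub M))
        value c = funI M c (emptyVec (nullary c)) , fromWitness (c , _ , refl)
        complete : ∀ x → x ∈ List.map value cs
        complete (x , x∈) with toWitness x∈
        ... | c , xs , c≡x =
          subst (_∈ List.map value cs)
                (sub-≡ (valueSub M) (trans (cong (funI M c) (sym (emptyVec-unique (nullary c) xs))) c≡x) _ x∈)
                (∈-map⁺ value (cs-complete c))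

    module FreshConstants (M : Str L) (a₀ : Carrier M) (cs : List Fun) where

      collapse : Carrier M ⊎ Fun → Carrier M
      collapse = fromInj₁ (const a₀)

      interpret : (c : Fun) → Dec (c ∈ cs) → Vec (Carrier M) (far c) → Carrier M ⊎ Fun
      interpret c (yes _) ys = inj₁ (funI M c ys)
      interpret c (no _)  _  = inj₂ c

      M⁺ : Str L
      M⁺ = record
        { Carrier = Carrier M ⊎ Fun
        ; relI    = λ R xs → relI M R (map collapse xs)
        ; funI    = λ c xs → interpret c em (map collapse xs)
        }

      collapse-inj₁ : ∀ {k} (ys : Vec (Carrier M) k) → map collapse (map inj₁ ys) ≡ ys
      collapse-inj₁ ys = trans (sym (map-∘ collapse inj₁ ys)) (map-id ys)

      interpret-∈ : ∀ {c} → c ∈ cs → (d : Dec (c ∈ cs)) (ys : Vec (Carrier M) (far c)) →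
                    interpret c d ys ≡ inj₁ (funI M c ys)
      interpret-∈ c∈cs (yes _)   ys = refl
      interpret-∈ c∈cs (no c∉cs) ys = contradiction c∈cs c∉cs

      interpret-∉ : ∀ {c} → c ∉ cs → (d : Dec (c ∈ cs)) (ys : Vec (Carrier M) (far c)) →
                    interpret c d ys ≡ inj₂ c
      interpret-∉ c∉cs (yes c∈cs) ys = contradiction c∈cs c∉cs
      interpret-∉ c∉cs (no _)     ys = refl

      inj₁-preservesFuns : PreservesFuns {M} {M⁺} inj₁ cs
      inj₁-preservesFuns {c} c∈cs ys =
        sym (trans (interpret-∈ c∈cs em _) (cong (inj₁ ∘ funI M c) (collapse-inj₁ ys)))

      inj₁-respectsRels : RespectsRels {M} {M⁺} inj₁
      inj₁-respectsRels R ys =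
        mk⇔ (subst (relI M R) (sym (collapse-inj₁ ys))) (subst (relI M R) (collapse-inj₁ ys))

      inj₂∈everySub : (∀ f → far f ≡ 0) → ∀ {c} → c ∉ cs → (S : Sub L M⁺) → Sub.mem S (inj₂ c)
      inj₂∈everySub nullary {c} c∉cs S =
        subst (Sub.mem S) (interpret-∉ c∉cs em _) (Sub.closed S c xs (All-emptyVec (nullary c) xs))
        where
          xs : Vec (Carrier M ⊎ Fun) (far c)
          xs = emptyVec (nullary c)

      finiteSub⇒enumerable : (∀ f → far f ≡ 0) → (S : Sub L M⁺) → FiniteSub L S → Enumerable Fun
      finiteSub⇒enumerable nullary S (m , S↔Fin) = cs ++ mapMaybe constantOf (allFin m) , complete
        where
          open Inverse S↔Fin
          constantOf : Fin m → Maybe Fun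
          constantOf = isInj₂ ∘ proj₁ ∘ from
          complete : ∀ c → c ∈ cs ++ mapMaybe constantOf (allFin m)
          complete c with em {c ∈ cs}
          ... | yes c∈cs = ∈-++⁺ˡ c∈cs
          ... | no c∉cs  = ∈-++⁺ʳ cs (mapMaybe⁺ constantOf (allFin m) (map⁺ (Any.map found (∈-allFin i))))
            where
              c∈S : Sub.mem S (inj₂ c)
              c∈S = inj₂∈everySub nullary c∉cs S
              i : Fin m
              i = to (inj₂ c , c∈S)
              found : ∀ {j} → i ≡ j → MAny.Any (c ≡_) (constantOf j)
              found refl =
                subst (MAny.Any (c ≡_)) (sym (cong (isInj₂ ∘ proj₁) (strictlyInverseʳ (inj₂ c , c∈S))))
                      (MAny.just refl)

    FIT⇒pointed-member : ∀ {K} → UniversallyAxiomatizable L K → FIT L K → (∀ f → far f ≡ 0) →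
      ¬ Enumerable Fun → (M : Str L) → Carrier M → K M
    FIT⇒pointed-member {K} (T , K⇔T) (_ , fromFiniteSubs , _) nullary ¬enum M a₀ = proj₂ (K⇔T M) M⊨T
      where
        M⊨T : ModU L T M
        M⊨T (∀[ n ] ψ) ψ∈T =
          satU-reflect inj₁ inj₁-injective inj₁-respectsRels ψ inj₁-preservesFuns
            (proj₁ (K⇔T M⁺) KM⁺ _ ψ∈T)
          where
            open FreshConstants M a₀ (funSymsQ ψ)
            KM⁺ : K M⁺
            KM⁺ = fromFiniteSubs M⁺ λ S S-fin → ⊥-elim (¬enum (finiteSub⇒enumerable nullary S S-fin))

  UNCAF⇒counterexample : ∀ {K} → UNCAF L K → FiniteMember K → InfiniteMember K →
    FiniteSubCounterexample (InfiniteMembers L K)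
  UNCAF⇒counterexample _ (F , _ , zero , F↔Fin) (M , KM , M-inf) =
    infiniteMembers-counterexample KM M-inf (emptySub F F-empty M) (emptySub-finite F F-empty M)
    where
      F-empty : ¬ Carrier F
      F-empty = ¬Fin0 ∘ Inverse.to F↔Fin
  UNCAF⇒counterexample uncaf (F , KF , F-fin@(suc n , F↔Fin)) _ =
    infiniteMembers-counterexample (UNCAF⇒homomorphism-closed uncaf _ (collapse-isHomomorphism F a₀) KF)
      ⊎ℕ-infinite (inflate-inj₁Sub F a₀) (inj₁-part-finite F-fin)
    where
      a₀ : Carrier F
      a₀ = Inverse.from F↔Fin zero

  FIT⇒counterexample : ExcludedMiddle 0ℓ → ∀ {K} → UniversallyAxiomatizable L K → FIT L K →
    FiniteMember K → InfiniteMember K → FiniteSubCounterexample (InfiniteMembers L K)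
  FIT⇒counterexample em ua fit (F , KF , F-fin) (M , KM , M-inf) with em {∃[ f ] far f ≢ 0}
  ... | yes (f₀ , f₀-nonconstant) =
    infiniteMembers-counterexample (FIT⇒succExt-member ua fit f₀-nonconstant KF)
      ⊎ℕ-infinite (succExt-inj₁Sub F) (inj₁-part-finite F-fin)
  ... | no no-nonconstant with em {Enumerable Fun}
  ...   | yes enum =
    infiniteMembers-counterexample KM M-inf (valueSub em M)
      (valueSub-finite em M (¬nonconstant⇒nullary no-nonconstant) enum)
  ...   | no ¬enum =
    infiniteMembers-counterexample
      (FIT⇒pointed-member em ua fit (¬nonconstant⇒nullary no-nonconstant) ¬enum (succExt F) (inj₂ 0))
      ⊎ℕ-infinite (succExt-inj₁Sub F) (inj₁-part-finite F-fin)

mainTheorem13 : ExcludedMiddle 0ℓ → ExcludedMiddle (Level.suc 0ℓ) →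
    (L : Language) (K : Class L) →
    UniversallyAxiomatizable L K →
    (FIT L K ⊎ UNCAF L K) →
    Σ (Str L) (λ M → K M × Finite (Str.Carrier M)) →
    Σ (Str L) (λ M → K M × Infinite (Str.Carrier M)) →
    ¬ FIT L (InfiniteMembers L K) × ¬ fgFIT L (InfiniteMembers L K) × ¬ UNCAF L (InfiniteMembers L K)
mainTheorem13 em _ L K ua FIT⊎UNCAF finite infinite =
  counterexample⇒¬FIT L cex , counterexample⇒¬fgFIT L cex , counterexample⇒¬UNCAF L cex
  where
    cex : FiniteSubCounterexample L (InfiniteMembers L K)
    cex = [ (λ fit → FIT⇒counterexample L em ua fit finite infinite)
          , (λ uncaf → UNCAF⇒counterexample L uncaf finite infinite) ]′ FIT⊎UNCAF
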